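{- Let $\tau$ be a type constructor in the monad class, with operations $\mathrm{return} :: \alpha \to \tau\cdot\alpha$ and bind $(\mathbin{>\!\!>\!\!=}) :: \tau\cdot\alpha \to (\alpha \to \tau\cdot\beta) \to \tau\cdot\beta$. Bind is strict in its first argument if its second argument is also strict: for every continuous function $k :: \alpha \to \tau\cdot\beta$, if $k\;\bot = \bot$ then $\bot \mathbin{>\!\!>\!\!=} k = \bot$.
   Context: The setting is domain theory as formalized in Isabelle/HOLCF: all types are pointed complete partial orders (domains) with a least element $\bot$ and order $\sqsubseteq$, all functions are continuous (hence monotone), and $\tau\cdot\alpha$ denotes application of a type constructor $\tau$ to a type $\alpha$. A type constructor $\tau$ is in the monad class if it has operations $\mathrm{return}$ and $(\mathbin{>\!\!>\!\!=})$ satisfying the polymorphic monad laws: left unit $\mathrm{return}\;a \mathbin{>\!\!>\!\!=} k = k\;a$, right unit $m \mathbin{>\!\!>\!\!=} \mathrm{return} = m$, and associativity $(m \mathbin{>\!\!>\!\!=} h) \mathbin{>\!\!>\!\!=} k = m \mathbin{>\!\!>\!\!=} (\lambda x.\; h\;x \mathbin{>\!\!>\!\!=} k)$. The result is a generic theorem valid for every monad instance. -}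

module Defs where

open import Data.Nat using (ℕ; suc)
open import Data.Product using (_×_)
open import Relation.Binary.PropositionalEquality using (_≡_)

record Domain : Set₁ where
  infix 4 _⊑_
  field
    Carrier   : Set
    _⊑_       : Carrier → Carrier → Set
    ⊑-refl    : ∀ {x} → x ⊑ x
    ⊑-trans   : ∀ {x y z} → x ⊑ y → y ⊑ z → x ⊑ z
    ⊑-antisym : ∀ {x y} → x ⊑ y → y ⊑ x → x ≡ y

  IsChain : (ℕ → Carrier) → Set
  IsChain c = ∀ n → c n ⊑ c (suc n)

  IsLub : (ℕ → Carrier) → Carrier → Set
  IsLub c x = (∀ n → c n ⊑ x) × (∀ y → (∀ n → c n ⊑ y) → x ⊑ y)

  field
    lub       : (c : ℕ → Carrier) → IsChain c → Carrier
    lub-isLub : (c : ℕ → Carrier) (ch : IsChain c) → IsLub c (lub c ch)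
    ⊥         : Carrier
    ⊥-least   : ∀ x → ⊥ ⊑ x

open Domain public using (Carrier)

record Cont (A B : Domain) : Set where
  private
    module A = Domain A
    module B = Domain B
  field
    app  : Carrier A → Carrier B
    mono : ∀ {x y} → x A.⊑ y → app x B.⊑ app y
    cont : ∀ (c : ℕ → Carrier A) (ch : A.IsChain c) →
           B.IsLub (λ n → app (c n)) (app (A.lub c ch))

open Cont public using (app)

-- A monad on the category of domains and continuous functions.
-- bind :: τ·α → (α → τ·β) → τ·β is continuous in each argument separately
-- (equivalent to continuity of the curried function in HOLCF); the
-- second argument ranges over the continuous function space ordered and
-- with lubs taken pointwise.
record Monad : Set₂ where
  field
    τ      : Domain → Domain
    return : ∀ {A} → Cont A (τ A)
    bind   : ∀ {A B} → Carrier (τ A) → Cont A (τ B) → Carrier (τ B)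

    bind-mono₁ : ∀ {A B} (k : Cont A (τ B)) {m m′ : Carrier (τ A)} →
                 Domain._⊑_ (τ A) m m′ → Domain._⊑_ (τ B) (bind m k) (bind m′ k)
    bind-cont₁ : ∀ {A B} (k : Cont A (τ B)) (c : ℕ → Carrier (τ A))
                 (ch : Domain.IsChain (τ A) c) →
                 Domain.IsLub (τ B) (λ n → bind (c n) k) (bind (Domain.lub (τ A) c ch) k)
    bind-mono₂ : ∀ {A B} (m : Carrier (τ A)) {k k′ : Cont A (τ B)} →
                 (∀ x → Domain._⊑_ (τ B) (app k x) (app k′ x)) →
                 Domain._⊑_ (τ B) (bind m k) (bind m k′)
    bind-cont₂ : ∀ {A B} (m : Carrier (τ A)) (ks : ℕ → Cont A (τ B)) →
                 (∀ n x → Domain._⊑_ (τ B) (app (ks n) x) (app (ks (suc n)) x)) →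
                 (k : Cont A (τ B)) →
                 (∀ x → Domain.IsLub (τ B) (λ n → app (ks n) x) (app k x)) →
                 Domain.IsLub (τ B) (λ n → bind m (ks n)) (bind m k)

    left-unit  : ∀ {A B} (a : Carrier A) (k : Cont A (τ B)) →
                 bind (app return a) k ≡ app k a
    right-unit : ∀ {A} (m : Carrier (τ A)) → bind m return ≡ m
    assoc      : ∀ {A B C} (m : Carrier (τ A)) (h : Cont A (τ B)) (k : Cont B (τ C))
                 (g : Cont A (τ C)) → (∀ x → app g x ≡ bind (app h x) k) →
                 bind (bind m h) k ≡ bind m g

-- Idea: ⊥ is below every element, in particular below `return ⊥`.  Since
-- bind is monotone in its first argument, `⊥ >>= k ⊑ return ⊥ >>= k`, and
-- the left-unit law rewrites the right-hand side to `k ⊥`.  This gives the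
-- general bound `⊥ >>= k ⊑ k ⊥`, valid for every continuation k.  If k is
-- strict, the bound is `⊥ >>= k ⊑ ⊥`, and an element below ⊥ equals ⊥.
module Submission where

open import Defs
open import Relation.Binary.PropositionalEquality using (_≡_; subst)

below-⊥⇒≡⊥ : (D : Domain) {x : Carrier D} →
             Domain._⊑_ D x (Domain.⊥ D) → x ≡ Domain.⊥ D
below-⊥⇒≡⊥ D x⊑⊥ = Domain.⊑-antisym D x⊑⊥ (Domain.⊥-least D _)

bind-⊥-⊑-app-⊥ : (M : Monad) → let open Monad M in
                 ∀ {A B : Domain} (k : Cont A (τ B)) →
                 Domain._⊑_ (τ B) (bind (Domain.⊥ (τ A)) k) (app k (Domain.⊥ A))
bind-⊥-⊑-app-⊥ M {A} {B} k =
  subst (Domain._⊑_ (τ B) (bind (Domain.⊥ (τ A)) k))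
        (left-unit (Domain.⊥ A) k)
        (bind-mono₁ k (Domain.⊥-least (τ A) (app return (Domain.⊥ A))))
  where open Monad M

theorem4 : (M : Monad) → let open Monad M in
    ∀ {A B : Domain} (k : Cont A (τ B)) →
    app k (Domain.⊥ A) ≡ Domain.⊥ (τ B) →
    bind (Domain.⊥ (τ A)) k ≡ Domain.⊥ (τ B)
theorem4 M {A} {B} k k-strict =
  below-⊥⇒≡⊥ (τ B)
    (subst (Domain._⊑_ (τ B) (bind (Domain.⊥ (τ A)) k)) k-strict
           (bind-⊥-⊑-app-⊥ M k))
  where open Monad M
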